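{- Let $D$ be a $k$-fold circuit in a matroid $\mathcal{M}$ such that $\mathcal{M}|_D$ is disconnected, and let $D_1,D_2,\ldots,D_s$ be the connected components of $\mathcal{M}|_D$. If, for each $1\leq i\leq s$, $D_i$ is a balanced $k_i$-fold circuit, then $D$ is a balanced $k$-fold circuit.
   Context: Matroids have finite ground sets. For $\mathcal{M}=(E,r)$ with closure operator $\mathrm{cl}(X)=\{x: r(X+x)=r(X)\}$: a cyclic set is a set $D$ with $r(D-e)=r(D)$ for all $e\in D$; a $k$-fold circuit is a cyclic set $D$ with $r(D)=|D|-k$. The principal partition of a $k$-fold circuit $D$ is $\{D\setminus B: B\subseteq D \text{ a } (k-1)\text{ -fold circuit}\}$, a partition of $D$. A $k$-fold circuit $D$ with principal partition $\{A_1,\dots,A_\ell\}$ is balanced if $r\big(\bigcap_{i=1}^\ell \mathrm{cl}(D\setminus A_i)\big)=\ell-k$. The components of a matroid are the classes of the equivalence relation $e\sim f$ iff $e=f$ or some circuit contains both; a matroid is connected if it has one component, and disconnected otherwise. -}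

module Defs where

open import Data.Nat using (ℕ; _+_; _≤_; _<_; suc)
open import Data.Fin using (Fin)
open import Data.Fin.Subset using (Subset; _∈_; _⊆_; _⊂_; _∪_; _∩_; _─_; _-_; ∣_∣; ⁅_⁆; ⊥; ⊤)
open import Data.List using (List; map; foldr; length)
open import Data.List.Relation.Unary.Unique.Propositional using (Unique)
import Data.List.Membership.Propositional as LM
open import Data.Product using (Σ; ∃; ∃-syntax; _×_; _,_)
open import Data.Sum using (_⊎_)
open import Relation.Binary.PropositionalEquality using (_≡_)
open import Relation.Nullary using (¬_)
open import Function.Bundles using (_⇔_)

record Matroid (n : ℕ) : Set where
  field
    r           : Subset n → ℕ
    r-bounded   : ∀ X → r X ≤ ∣ X ∣
    r-monotone  : ∀ X Y → X ⊆ Y → r X ≤ r Y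
    r-submod    : ∀ X Y → r (X ∪ Y) + r (X ∩ Y) ≤ r X + r Y

module _ {n : ℕ} (M : Matroid n) where
  open Matroid M

  cl : Subset n → Subset n
  cl X = go
    where
      open import Data.Vec using (tabulate)
      open import Data.Nat using (_≡ᵇ_)
      open import Data.Bool using (Bool)
      go : Subset n
      go = tabulate (λ x → r (X ∪ ⁅ x ⁆) ≡ᵇ r X)

  Cyclic : Subset n → Set
  Cyclic D = ∀ e → e ∈ D → r (D - e) ≡ r D

  -- j-fold circuit: cyclic with r(D) = |D| - j (written additively)
  FoldCircuit : ℕ → Subset n → Set
  FoldCircuit j D = Cyclic D × (r D + j ≡ ∣ D ∣)

  -- B is a (k-1)-fold circuit, i.e. cyclic with r(B) = |B| - (k - 1),
  -- written additively so that k = 0 makes no (-1)-fold circuits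
  PredFoldCircuit : ℕ → Subset n → Set
  PredFoldCircuit k B = Cyclic B × (r B + k ≡ suc ∣ B ∣)

  -- the list As enumerates (without repetition) the principal partition
  -- { D \ B : B ⊆ D a (k-1)-fold circuit } of D
  EnumeratesPrincipalPartition : ℕ → Subset n → List (Subset n) → Set
  EnumeratesPrincipalPartition k D As =
    Unique As ×
    (∀ A → (A LM.∈ As) ⇔ (∃[ B ] (B ⊆ D × PredFoldCircuit k B × A ≡ D ─ B)))

  ⋂ : List (Subset n) → Subset n
  ⋂ = foldr _∩_ ⊤

  -- balanced k-fold circuit: with principal partition {A_1..A_ℓ},
  -- r(⋂_i cl(D \ A_i)) = ℓ - k  (written additively)
  Balanced : ℕ → Subset n → Set
  Balanced k D =
    FoldCircuit k D ×
    Σ (List (Subset n)) (λ As →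
      EnumeratesPrincipalPartition k D As ×
      (r (⋂ (map (λ A → cl (D ─ A)) As)) + k ≡ length As))

  Dependent : Subset n → Set
  Dependent X = r X < ∣ X ∣

  Circuit : Subset n → Set
  Circuit C = Dependent C × (∀ X → X ⊂ C → ¬ Dependent X)

  -- e ~ f in the restriction M|_D: e = f or some circuit of M|_D
  -- (i.e. circuit of M contained in D) contains both
  Related : Subset n → Fin n → Fin n → Set
  Related D e f = e ≡ f ⊎ (∃[ C ] (Circuit C × C ⊆ D × e ∈ C × f ∈ C))

  IsComponent : Subset n → Subset n → Set
  IsComponent D C = ∃[ e ] (e ∈ D × (∀ f → (f ∈ C) ⇔ (f ∈ D × Related D e f)))

  RestrictionDisconnected : Subset n → Set
  RestrictionDisconnected D = ∃[ e ] ∃[ f ] (e ∈ D × f ∈ D × ¬ Related D e f)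

-- The components of M|D are pairwise skew: if r (C ∪ R) < r C + r R for a component C and a union R
-- of other components, a circuit inside the union of bases of C and R would meet both and link them.
-- So it suffices to show that D₁ ∪ D₂ is balanced whenever D₁ and D₂ are disjoint, skew, balanced
-- k₁- and k₂-fold circuits. Nullity is additive on such pairs, so D₁ ∪ D₂ is a (k₁ + k₂)-fold
-- circuit whose (k₁ + k₂ - 1)-fold circuits are exactly the sets B₁ ∪ D₂ and D₁ ∪ B₂ with Bᵢ a
-- (kᵢ - 1)-fold circuit of Dᵢ; hence its principal partition is the union of those of D₁ and D₂,
-- and ℓ = ℓ₁ + ℓ₂. The flat ⋂ cl (D ─ Aᵢ) contains the corresponding flats of D₁ and D₂, which are
-- skew, so its rank is at least (ℓ₁ - k₁) + (ℓ₂ - k₂) = ℓ - k. Conversely every k-fold circuit has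
-- r (⋂ cl (D ─ Aᵢ)) ≤ ℓ - k: intersecting the closures one piece at a time, submodularity makes
-- each step lose at least ∣ Aᵢ ∣ - 1 in rank, and the pieces partition D.
module Submission where

open import Defs
open import Data.Nat using (ℕ)
open import Data.Fin.Subset using (Subset)
open import Data.Product using (∃-syntax)

open import Data.Bool using (Bool; T)
open import Data.Bool.Properties using (T-≡)
open import Data.Empty using (⊥-elim)
open import Data.Fin using (Fin; zero; suc) renaming (_≟_ to _≟ᶠ_)
open import Data.Fin.Properties using (any?)
open import Data.Fin.Subset
  using (_∈_; _∉_; _⊆_; _⊂_; _∪_; _∩_; _─_; _-_; ∣_∣; ⁅_⁆; ⊥; ⊤; ⋃; inside; outside; Nonempty)
open import Data.Fin.Subset.Properties
open import Data.List using (List; []; _∷_; _++_; map; length)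
open import Data.List.Membership.Propositional using () renaming (_∈_ to _∈ₗ_)
open import Data.List.Membership.Propositional.Properties using (∈-++⁺ˡ; ∈-++⁺ʳ; ∈-++⁻)
open import Data.List.Properties using (length-++)
open import Data.List.Relation.Binary.Subset.Propositional using () renaming (_⊆_ to _⊆ₗ_)
import Data.List.Relation.Unary.All as All
open import Data.List.Relation.Unary.AllPairs using (_∷_)
open import Data.List.Relation.Unary.Any using (here; there)
open import Data.List.Relation.Unary.Unique.Propositional using (Unique)
open import Data.List.Relation.Unary.Unique.Propositional.Properties using (++⁺)
open import Data.Nat using (suc; _+_; _≤_; _<_; _∸_; _≟_; _<?_; s≤s)
open import Data.Nat.Induction using (<-wellFounded)
open import Data.Nat.ListAction using (sum)
open import Data.Nat.Properties
open import Algebra.Properties.CommutativeSemigroup +-commutativeSemigroup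
  using (x∙yz≈xz∙y; x∙yz≈y∙xz; xy∙z≈xz∙y; interchange)
open import Data.Product using (_×_; _,_; proj₁; proj₂; uncurry)
open import Data.Sum using (_⊎_; inj₁; inj₂; [_,_]′)
import Data.Sum as Sum
open import Data.Vec using ([]; _∷_; tabulate; here; there)
open import Data.Vec.Properties using ([]=⇒lookup; lookup⇒[]=; lookup∘tabulate)
open import Function using (_∘_; id)
open import Function.Bundles using (Equivalence; mk⇔)
open import Induction.WellFounded using (Acc; acc)
open import Relation.Binary.PropositionalEquality
open import Relation.Nullary using (¬_; Dec; yes; no; ¬?)
open import Relation.Nullary.Decidable using (_×-dec_; _⊎-dec_; isYes; toWitness; fromWitness)
open import Relation.Unary using (Decidable)

private
  variable
    m n j k : ℕ
    p q s t : Subset n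
    x y : Fin n

1+m+n≡j+k⇒1+m≡j⊎1+n≡k : m ≤ j → n ≤ k → suc (m + n) ≡ j + k →
                        (suc m ≡ j × n ≡ k) ⊎ (m ≡ j × suc n ≡ k)
1+m+n≡j+k⇒1+m≡j⊎1+n≡k {m} {j} {n} {k} m≤j n≤k eq with n ≟ k
... | yes refl = inj₁ (+-cancelʳ-≡ n _ _ eq , refl)
... | no n≢k = inj₂ (m≡j , +-cancelˡ-≡ m _ _ (trans (+-suc m n) (trans eq (cong (_+ k) (sym m≡j)))))
  where
  open ≤-Reasoning
  m≡j : m ≡ j
  m≡j = ≤-antisym m≤j (+-cancelʳ-≤ k _ _ (begin
    j + k        ≡⟨ sym eq ⟩
    suc (m + n)  ≡⟨ sym (+-suc m n) ⟩
    m + suc n    ≤⟨ +-monoʳ-≤ m (≤∧≢⇒< n≤k n≢k) ⟩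
    m + k        ∎))

-- Finite sets

Disjoint : Subset n → Subset n → Set
Disjoint p q = ∀ {x} → x ∈ p → x ∉ q

disjoint-sym : Disjoint p q → Disjoint q p
disjoint-sym p#q x∈q x∈p = p#q x∈p x∈q

x∈p─q⇒x∉q : ∀ (p q : Subset n) → x ∈ p ─ q → x ∉ q
x∈p─q⇒x∉q (_ ∷ p) (inside ∷ q) () here
x∈p─q⇒x∉q {x = zero} (_ ∷ p) (outside ∷ q) _ ()
x∈p─q⇒x∉q {x = suc x} (_ ∷ p) (_ ∷ q) (there x∈p─q) (there x∈q) = x∈p─q⇒x∉q p q x∈p─q x∈q

x∈p─q⁻ : x ∈ p ─ q → x ∈ p × x ∉ q
x∈p─q⁻ {p = p} {q} x∈p─q = p─q⊆p p q x∈p─q , x∈p─q⇒x∉q p q x∈p─q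

x∈p-y⁻ : x ∈ p - y → x ∈ p × x ≢ y
x∈p-y⁻ x∈p-y = let (x∈p , x∉y) = x∈p─q⁻ x∈p-y in x∈p , x∉⁅y⁆⇒x≢y x∉y

x∉p∧x∉q⇒x∉p∪q : x ∉ p → x ∉ q → x ∉ p ∪ q
x∉p∧x∉q⇒x∉p∪q {p = p} {q = q} x∉p x∉q x∈p∪q = [ x∉p , x∉q ]′ (x∈p∪q⁻ p q x∈p∪q)

x∈tabulate⁺ : {f : Fin n → Bool} → T (f x) → x ∈ tabulate f
x∈tabulate⁺ {x = x} {f} fx = lookup⇒[]= x _ (trans (lookup∘tabulate f x) (Equivalence.to T-≡ fx))

x∈tabulate⁻ : {f : Fin n → Bool} → x ∈ tabulate f → T (f x)
x∈tabulate⁻ {x = x} {f} x∈ = Equivalence.from T-≡ (trans (sym (lookup∘tabulate f x)) ([]=⇒lookup x∈))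

⊈⇒∃∉ : ¬ (p ⊆ q) → ∃[ x ] (x ∈ p × x ∉ q)
⊈⇒∃∉ {p = p} {q} p⊈q with any? (λ x → x ∈? p ×-dec ¬? (x ∈? q))
... | yes witness = witness
... | no none = ⊥-elim (p⊈q p⊆q)
  where
  p⊆q : p ⊆ q
  p⊆q {x} x∈p with x ∈? q
  ... | yes x∈q = x∈q
  ... | no x∉q = ⊥-elim (none (x , x∈p , x∉q))

∪-lub : p ⊆ s → q ⊆ s → p ∪ q ⊆ s
∪-lub {p = p} {q = q} p⊆s q⊆s x∈p∪q = [ p⊆s , q⊆s ]′ (x∈p∪q⁻ p q x∈p∪q)

∪-mono : p ⊆ q → s ⊆ t → p ∪ s ⊆ q ∪ t
∪-mono {q = q} {t = t} p⊆q s⊆t = ∪-lub (p⊆p∪q t ∘ p⊆q) (q⊆p∪q q t ∘ s⊆t)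

⁅x⁆⊆p : x ∈ p → ⁅ x ⁆ ⊆ p
⁅x⁆⊆p {x = x} {p = p} x∈p y∈⁅x⁆ = subst (_∈ p) (sym (x∈⁅y⁆⇒x≡y x y∈⁅x⁆)) x∈p

p⊆q∧x∉p⇒p⊆q-x : p ⊆ q → x ∉ p → p ⊆ q - x
p⊆q∧x∉p⇒p⊆q-x p⊆q x∉p y∈p = x∈p∧x≢y⇒x∈p-y (p⊆q y∈p) (λ { refl → x∉p y∈p })

p⊆q⇒p-x⊆q-x : p ⊆ q → p - x ⊆ q - x
p⊆q⇒p-x⊆q-x p⊆q y∈p-x = let (y∈p , y≢x) = x∈p-y⁻ y∈p-x in x∈p∧x≢y⇒x∈p-y (p⊆q y∈p) y≢x

p⊆q⇒p─s⊆q─s : p ⊆ q → p ─ s ⊆ q ─ s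
p⊆q⇒p─s⊆q─s p⊆q y∈p─s = let (y∈p , y∉s) = x∈p─q⁻ y∈p─s in x∈p∧x∉q⇒x∈p─q (p⊆q y∈p) y∉s

p∪[q─p]≡q : p ⊆ q → p ∪ (q ─ p) ≡ q
p∪[q─p]≡q {p = p} {q} p⊆q = ⊆-antisym (∪-lub p⊆q (p─q⊆p q p)) q⊆p∪[q─p]
  where
  q⊆p∪[q─p] : q ⊆ p ∪ (q ─ p)
  q⊆p∪[q─p] {x} x∈q with x ∈? p
  ... | yes x∈p = p⊆p∪q _ x∈p
  ... | no x∉p = q⊆p∪q p _ (x∈p∧x∉q⇒x∈p─q x∈q x∉p)

[p-x]∪⁅x⁆≡p : x ∈ p → (p - x) ∪ ⁅ x ⁆ ≡ p
[p-x]∪⁅x⁆≡p {x = x} {p = p} x∈p = trans (∪-comm (p - x) ⁅ x ⁆) (p∪[q─p]≡q (⁅x⁆⊆p x∈p))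

p─[p─q]≡q : q ⊆ p → p ─ (p ─ q) ≡ q
p─[p─q]≡q {q = q} {p = p} q⊆p = ⊆-antisym ⊆q q⊆
  where
  ⊆q : p ─ (p ─ q) ⊆ q
  ⊆q {x} x∈ with x ∈? q
  ... | yes x∈q = x∈q
  ... | no x∉q = let (x∈p , x∉p─q) = x∈p─q⁻ x∈ in ⊥-elim (x∉p─q (x∈p∧x∉q⇒x∈p─q x∈p x∉q))
  q⊆ : q ⊆ p ─ (p ─ q)
  q⊆ x∈q = x∈p∧x∉q⇒x∈p─q (q⊆p x∈q) (λ x∈p─q → proj₂ (x∈p─q⁻ x∈p─q) x∈q)

p⊆q⇒p∩q≡p : p ⊆ q → p ∩ q ≡ p
p⊆q⇒p∩q≡p {p = p} {q = q} p⊆q = ⊆-antisym (p∩q⊆p p q) (λ x∈p → x∈p∩q⁺ (x∈p , p⊆q x∈p))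

[p∪q]-x≡[p-x]∪q : x ∉ q → (p ∪ q) - x ≡ (p - x) ∪ q
[p∪q]-x≡[p-x]∪q {x = x} {q = q} {p = p} x∉q =
  ⊆-antisym ⊆[p-x]∪q (∪-lub (p⊆q⇒p-x⊆q-x (p⊆p∪q q)) (p⊆q∧x∉p⇒p⊆q-x (q⊆p∪q p q) x∉q))
  where
  ⊆[p-x]∪q : (p ∪ q) - x ⊆ (p - x) ∪ q
  ⊆[p-x]∪q y∈ with x∈p-y⁻ y∈
  ... | y∈p∪q , y≢x =
    [ (λ y∈p → p⊆p∪q q (x∈p∧x≢y⇒x∈p-y y∈p y≢x)) , q⊆p∪q _ q ]′ (x∈p∪q⁻ p q y∈p∪q)

[p∪q]─[s∪q]≡p─s : Disjoint p q → (p ∪ q) ─ (s ∪ q) ≡ p ─ s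
[p∪q]─[s∪q]≡p─s {p = p} {q = q} {s = s} p#q = ⊆-antisym ⊆p─s p─s⊆
  where
  ⊆p─s : (p ∪ q) ─ (s ∪ q) ⊆ p ─ s
  ⊆p─s x∈ with x∈p─q⁻ x∈
  ... | x∈p∪q , x∉s∪q =
    [ (λ x∈p → x∈p∧x∉q⇒x∈p─q x∈p (x∉s∪q ∘ p⊆p∪q q)) , ⊥-elim ∘ x∉s∪q ∘ q⊆p∪q s q ]′ (x∈p∪q⁻ p q x∈p∪q)
  p─s⊆ : p ─ s ⊆ (p ∪ q) ─ (s ∪ q)
  p─s⊆ x∈ with x∈p─q⁻ x∈
  ... | x∈p , x∉s = x∈p∧x∉q⇒x∈p─q (p⊆p∪q q x∈p) (x∉p∧x∉q⇒x∉p∪q x∉s (p#q x∈p))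

∣p∪q∣+∣p∩q∣≡∣p∣+∣q∣ : ∀ (p q : Subset n) → ∣ p ∪ q ∣ + ∣ p ∩ q ∣ ≡ ∣ p ∣ + ∣ q ∣
∣p∪q∣+∣p∩q∣≡∣p∣+∣q∣ [] [] = refl
∣p∪q∣+∣p∩q∣≡∣p∣+∣q∣ (inside ∷ p) (inside ∷ q) = cong suc (begin
  ∣ p ∪ q ∣ + suc ∣ p ∩ q ∣  ≡⟨ +-suc _ _ ⟩
  suc (∣ p ∪ q ∣ + ∣ p ∩ q ∣) ≡⟨ cong suc (∣p∪q∣+∣p∩q∣≡∣p∣+∣q∣ p q) ⟩
  suc (∣ p ∣ + ∣ q ∣)        ≡⟨ sym (+-suc _ _) ⟩
  ∣ p ∣ + suc ∣ q ∣          ∎)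
  where open ≡-Reasoning
∣p∪q∣+∣p∩q∣≡∣p∣+∣q∣ (inside ∷ p) (outside ∷ q) = cong suc (∣p∪q∣+∣p∩q∣≡∣p∣+∣q∣ p q)
∣p∪q∣+∣p∩q∣≡∣p∣+∣q∣ (outside ∷ p) (inside ∷ q) =
  trans (cong suc (∣p∪q∣+∣p∩q∣≡∣p∣+∣q∣ p q)) (sym (+-suc _ _))
∣p∪q∣+∣p∩q∣≡∣p∣+∣q∣ (outside ∷ p) (outside ∷ q) = ∣p∪q∣+∣p∩q∣≡∣p∣+∣q∣ p q

∣p∪q∣≤∣p∣+∣q∣ : ∀ (p q : Subset n) → ∣ p ∪ q ∣ ≤ ∣ p ∣ + ∣ q ∣
∣p∪q∣≤∣p∣+∣q∣ p q = ≤-trans (m≤m+n _ _) (≤-reflexive (∣p∪q∣+∣p∩q∣≡∣p∣+∣q∣ p q))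

∣p∪q∣≡∣p∣+∣q∣ : Disjoint p q → ∣ p ∪ q ∣ ≡ ∣ p ∣ + ∣ q ∣
∣p∪q∣≡∣p∣+∣q∣ {n} {p} {q} p#q = begin
  ∣ p ∪ q ∣              ≡⟨ sym (+-identityʳ _) ⟩
  ∣ p ∪ q ∣ + 0          ≡⟨ cong (∣ p ∪ q ∣ +_) (sym ∣p∩q∣≡0) ⟩
  ∣ p ∪ q ∣ + ∣ p ∩ q ∣  ≡⟨ ∣p∪q∣+∣p∩q∣≡∣p∣+∣q∣ p q ⟩
  ∣ p ∣ + ∣ q ∣          ∎
  where
  open ≡-Reasoning
  p∩q≡⊥ : p ∩ q ≡ ⊥
  p∩q≡⊥ = ⊆-antisym (λ x∈ → let (x∈p , x∈q) = x∈p∩q⁻ p q x∈ in ⊥-elim (p#q x∈p x∈q)) ⊥⊆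
  ∣p∩q∣≡0 : ∣ p ∩ q ∣ ≡ 0
  ∣p∩q∣≡0 = trans (cong ∣_∣ p∩q≡⊥) (∣⊥∣≡0 n)

∣q∣≡∣p∣+∣q─p∣ : p ⊆ q → ∣ q ∣ ≡ ∣ p ∣ + ∣ q ─ p ∣
∣q∣≡∣p∣+∣q─p∣ {p = p} {q} p⊆q =
  trans (cong ∣_∣ (sym (p∪[q─p]≡q p⊆q))) (∣p∪q∣≡∣p∣+∣q∣ (λ x∈p x∈q─p → x∈p─q⇒x∉q q p x∈q─p x∈p))

∣p∣≡1+∣p-x∣ : x ∈ p → ∣ p ∣ ≡ suc ∣ p - x ∣
∣p∣≡1+∣p-x∣ {x = x} {p = p} x∈p =
  trans (∣q∣≡∣p∣+∣q─p∣ (⁅x⁆⊆p x∈p)) (cong (_+ ∣ p - x ∣) (∣⁅x⁆∣≡1 x))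

∈⋃⁺ : ∀ {L : List (Subset n)} → p ∈ₗ L → x ∈ p → x ∈ ⋃ L
∈⋃⁺ {L = p ∷ L} (here refl) x∈p = p⊆p∪q (⋃ L) x∈p
∈⋃⁺ {L = q ∷ L} (there p∈L) x∈p = q⊆p∪q q (⋃ L) (∈⋃⁺ p∈L x∈p)

∣⋃∣≤Σ∣∣ : ∀ (L : List (Subset n)) → ∣ ⋃ L ∣ ≤ sum (map ∣_∣ L)
∣⋃∣≤Σ∣∣ {n} [] = ≤-reflexive (∣⊥∣≡0 n)
∣⋃∣≤Σ∣∣ (p ∷ L) = ≤-trans (∣p∪q∣≤∣p∣+∣q∣ p (⋃ L)) (+-monoʳ-≤ ∣ p ∣ (∣⋃∣≤Σ∣∣ L))

⊆-minimal : {P : Subset n → Set} → Decidable P → P p →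
            ∃[ q ] (q ⊆ p × P q × (∀ s → s ⊂ q → ¬ P s))
⊆-minimal {p = p} {P} P? Pp = go p (<-wellFounded ∣ p ∣) Pp
  where
  go : ∀ p → Acc _<_ ∣ p ∣ → P p → ∃[ q ] (q ⊆ p × P q × (∀ s → s ⊂ q → ¬ P s))
  go p (acc smaller) Pp with anySubset? (λ s → s ⊂? p ×-dec P? s)
  ... | no none = p , ⊆-refl , Pp , λ s s⊂p Ps → none (s , s⊂p , Ps)
  ... | yes (s , s⊂p , Ps) =
    let (q , q⊆s , Pq , minimal) = go s (smaller (p⊂q⇒∣p∣<∣q∣ s⊂p)) Ps
    in q , ⊆-trans q⊆s (p⊂q⇒p⊆q s⊂p) , Pq , minimal

module _ {n : ℕ} (M : Matroid n) where
  open Matroid M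

  private
    variable
      k₁ k₂ : ℕ
      A B B′ C C₁ C₂ D D₁ D₂ R X X′ Y Y′ : Subset n
      a b c e : Fin n
      As : List (Subset n)

  -- Rank, nullity and closure

  r-mono : X ⊆ Y → r X ≤ r Y
  r-mono = r-monotone _ _

  r-submod-⊆ : X′ ⊆ X ∪ Y → Y′ ⊆ X ∩ Y → r X′ + r Y′ ≤ r X + r Y
  r-submod-⊆ {X′} {X} {Y} X′⊆ Y′⊆ = ≤-trans (+-mono-≤ (r-mono X′⊆) (r-mono Y′⊆)) (r-submod X Y)

  r-∪≤ : ∀ X Y → r (X ∪ Y) ≤ r X + r Y
  r-∪≤ X Y = ≤-trans (m≤m+n _ _) (r-submod X Y)

  r-∪≤r+∣∣ : ∀ X Y → r (X ∪ Y) ≤ r X + ∣ Y ∣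
  r-∪≤r+∣∣ X Y = ≤-trans (r-∪≤ X Y) (+-monoʳ-≤ (r X) (r-bounded Y))

  nullity : Subset n → ℕ
  nullity X = ∣ X ∣ ∸ r X

  r+nullity≡∣∣ : ∀ X → r X + nullity X ≡ ∣ X ∣
  r+nullity≡∣∣ X = m+[n∸m]≡n (r-bounded X)

  nullity-unique : r X + k ≡ ∣ X ∣ → nullity X ≡ k
  nullity-unique {X} eq = +-cancelˡ-≡ (r X) _ _ (trans (r+nullity≡∣∣ X) (sym eq))

  nullity-mono : Y ⊆ X → nullity Y ≤ nullity X
  nullity-mono {Y} {X} Y⊆X = +-cancelˡ-≤ (r X) _ _ (begin
    r X + nullity Y                ≤⟨ +-monoˡ-≤ (nullity Y) r[X]≤ ⟩
    r Y + ∣ X ─ Y ∣ + nullity Y    ≡⟨ xy∙z≈xz∙y (r Y) ∣ X ─ Y ∣ (nullity Y) ⟩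
    r Y + nullity Y + ∣ X ─ Y ∣    ≡⟨ cong (_+ ∣ X ─ Y ∣) (r+nullity≡∣∣ Y) ⟩
    ∣ Y ∣ + ∣ X ─ Y ∣              ≡⟨ sym (∣q∣≡∣p∣+∣q─p∣ Y⊆X) ⟩
    ∣ X ∣                          ≡⟨ sym (r+nullity≡∣∣ X) ⟩
    r X + nullity X                ∎)
    where
    open ≤-Reasoning
    r[X]≤ : r X ≤ r Y + ∣ X ─ Y ∣
    r[X]≤ = subst (λ Z → r Z ≤ r Y + ∣ X ─ Y ∣) (p∪[q─p]≡q Y⊆X) (r-∪≤r+∣∣ Y (X ─ Y))

  dependent-⊇ : Y ⊆ X → Dependent M Y → Dependent M X
  dependent-⊇ {Y} {X} Y⊆X r[Y]<∣Y∣ = begin-strict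
    r X               <⟨ m<m+n (r X) (<-≤-trans (m<n⇒0<n∸m r[Y]<∣Y∣) (nullity-mono Y⊆X)) ⟩
    r X + nullity X   ≡⟨ r+nullity≡∣∣ X ⟩
    ∣ X ∣             ∎
    where open ≤-Reasoning

  ∈cl⁺ : r (X ∪ ⁅ x ⁆) ≡ r X → x ∈ cl M X
  ∈cl⁺ {X} {x} eq = x∈tabulate⁺ (≡⇒≡ᵇ (r (X ∪ ⁅ x ⁆)) (r X) eq)

  ∈cl⁻ : x ∈ cl M X → r (X ∪ ⁅ x ⁆) ≡ r X
  ∈cl⁻ {x} {X} x∈clX = ≡ᵇ⇒≡ (r (X ∪ ⁅ x ⁆)) (r X) (x∈tabulate⁻ x∈clX)

  X⊆clX : X ⊆ cl M X
  X⊆clX x∈X = ∈cl⁺ (cong r (⊆-antisym (∪-lub ⊆-refl (⁅x⁆⊆p x∈X)) (p⊆p∪q _)))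

  cl-mono : X ⊆ Y → cl M X ⊆ cl M Y
  cl-mono {X} {Y} X⊆Y {x} x∈clX = ∈cl⁺ (≤-antisym (+-cancelʳ-≤ (r X) _ _ (begin
    r (Y ∪ ⁅ x ⁆) + r X    ≤⟨ r-submod-⊆ (∪-mono ⊆-refl (q⊆p∪q X _))
                                          (λ y∈X → x∈p∩q⁺ (X⊆Y y∈X , p⊆p∪q _ y∈X)) ⟩
    r Y + r (X ∪ ⁅ x ⁆)    ≡⟨ cong (r Y +_) (∈cl⁻ x∈clX) ⟩
    r Y + r X              ∎)) (r-mono (p⊆p∪q ⁅ x ⁆)))
    where open ≤-Reasoning

  r-∪-⊆cl : ∀ S → S ⊆ cl M X → r (X ∪ S) ≡ r X
  r-∪-⊆cl {X} S = go S (<-wellFounded ∣ S ∣)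
    where
    go : ∀ S → Acc _<_ ∣ S ∣ → S ⊆ cl M X → r (X ∪ S) ≡ r X
    go S (acc smaller) S⊆clX with nonempty? S
    ... | no S≡∅ = cong r (trans (cong (X ∪_) (Empty-unique S≡∅)) (∪-identityʳ X))
    ... | yes (s , s∈S) = begin
      r (X ∪ S)                    ≡⟨ cong r X∪S≡ ⟩
      r ((X ∪ (S - s)) ∪ ⁅ s ⁆)    ≡⟨ ∈cl⁻ (cl-mono (p⊆p∪q _) (S⊆clX s∈S)) ⟩
      r (X ∪ (S - s))              ≡⟨ go (S - s) (smaller (x∈p⇒∣p-x∣<∣p∣ s∈S)) (S⊆clX ∘ p─q⊆p S _) ⟩
      r X                          ∎
      where
      open ≡-Reasoning
      X∪S≡ : X ∪ S ≡ (X ∪ (S - s)) ∪ ⁅ s ⁆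
      X∪S≡ = trans (cong (X ∪_) (sym ([p-x]∪⁅x⁆≡p s∈S))) (sym (∪-assoc X _ _))

  r-cl : ∀ X → r (cl M X) ≡ r X
  r-cl X = ≤-antisym (≤-trans (r-mono (q⊆p∪q X _)) (≤-reflexive (r-∪-⊆cl (cl M X) ⊆-refl)))
                     (r-mono X⊆clX)

  cl-⊆ : X ⊆ cl M Y → cl M X ⊆ cl M Y
  cl-⊆ {X} {Y} X⊆clY {x} x∈clX = ∈cl⁺ (≤-antisym (begin
    r (Y ∪ ⁅ x ⁆)           ≤⟨ r-mono (∪-mono (p⊆p∪q X) ⊆-refl) ⟩
    r ((Y ∪ X) ∪ ⁅ x ⁆)     ≡⟨ ∈cl⁻ (cl-mono (q⊆p∪q Y X) x∈clX) ⟩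
    r (Y ∪ X)               ≡⟨ r-∪-⊆cl X X⊆clY ⟩
    r Y                     ∎) (r-mono (p⊆p∪q _)))
    where open ≤-Reasoning

  ∈cl[X-x]⇒r[X-x]≡r[X] : x ∈ X → x ∈ cl M (X - x) → r (X - x) ≡ r X
  ∈cl[X-x]⇒r[X-x]≡r[X] x∈X x∈cl = trans (sym (∈cl⁻ x∈cl)) (cong r ([p-x]∪⁅x⁆≡p x∈X))

  r[X-x]≡r[X]⇒∈cl[X-x] : x ∈ X → r (X - x) ≡ r X → x ∈ cl M (X - x)
  r[X-x]≡r[X]⇒∈cl[X-x] x∈X eq = ∈cl⁺ (trans (cong r ([p-x]∪⁅x⁆≡p x∈X)) (sym eq))

  r≤1+r[X-x] : x ∈ X → r X ≤ suc (r (X - x))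
  r≤1+r[X-x] {x} {X} x∈X = begin
    r X                      ≡⟨ cong r (sym ([p-x]∪⁅x⁆≡p x∈X)) ⟩
    r ((X - x) ∪ ⁅ x ⁆)      ≤⟨ r-∪≤r+∣∣ (X - x) ⁅ x ⁆ ⟩
    r (X - x) + ∣ ⁅ x ⁆ ∣    ≡⟨ cong (r (X - x) +_) (∣⁅x⁆∣≡1 x) ⟩
    r (X - x) + 1            ≡⟨ +-comm (r (X - x)) 1 ⟩
    suc (r (X - x))          ∎
    where open ≤-Reasoning

  -- Circuits

  dependent? : Decidable (Dependent M)
  dependent? X = r X <? ∣ X ∣

  dependent⇒circuit⊆ : Dependent M X → ∃[ C ] (C ⊆ X × Circuit M C)
  dependent⇒circuit⊆ dep with ⊆-minimal dependent? dep
  ... | C , C⊆X , depC , minimal = C , C⊆X , depC , minimal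

  circuit-nonempty : Circuit M C → Nonempty C
  circuit-nonempty {C} (r[C]<∣C∣ , _) with nonempty? C
  ... | yes nonempty = nonempty
  ... | no empty = ⊥-elim (n≮0 (subst (r C <_) ∣C∣≡0 r[C]<∣C∣))
    where
    ∣C∣≡0 : ∣ C ∣ ≡ 0
    ∣C∣≡0 = trans (cong ∣_∣ (Empty-unique empty)) (∣⊥∣≡0 n)

  circuit-∈cl : Circuit M C → e ∈ C → e ∈ cl M (C - e)
  circuit-∈cl {C} {e} (r[C]<∣C∣ , minimal) e∈C =
    r[X-x]≡r[X]⇒∈cl[X-x] e∈C (≤-antisym (r-mono (p─q⊆p C _)) (begin
      r C          ≤⟨ ≤-pred (≤-trans r[C]<∣C∣ (≤-reflexive (∣p∣≡1+∣p-x∣ e∈C))) ⟩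
      ∣ C - e ∣    ≤⟨ ≮⇒≥ (minimal (C - e) (x∈p⇒p-x⊂p e∈C)) ⟩
      r (C - e)    ∎))
    where open ≤-Reasoning

  circuit-⊆⇒⊇ : Circuit M C₁ → Circuit M C₂ → C₁ ⊆ C₂ → C₂ ⊆ C₁
  circuit-⊆⇒⊇ {C₁} {C₂} (depC₁ , _) (_ , minimal₂) C₁⊆C₂ with C₂ ⊆? C₁
  ... | yes C₂⊆C₁ = C₂⊆C₁
  ... | no C₂⊈C₁ = ⊥-elim (minimal₂ C₁ (C₁⊆C₂ , ⊈⇒∃∉ C₂⊈C₁) depC₁)

  basis : ∀ X → ∃[ I ] (I ⊆ X × ¬ Dependent M I × r I ≡ r X)
  basis X with ⊆-minimal {P = λ I → r I ≡ r X} (λ I → r I ≟ r X) refl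
  ... | I , I⊆X , r[I]≡r[X] , minimal = I , I⊆X , independent , r[I]≡r[X]
    where
    independent : ¬ Dependent M I
    independent depI with dependent⇒circuit⊆ depI
    ... | C , C⊆I , circ with circuit-nonempty circ
    ... | e , e∈C = minimal (I - e) (x∈p⇒p-x⊂p (C⊆I e∈C)) (trans r[I-e]≡r[I] r[I]≡r[X])
      where
      r[I-e]≡r[I] : r (I - e) ≡ r I
      r[I-e]≡r[I] = ∈cl[X-x]⇒r[X-x]≡r[X] (C⊆I e∈C)
                      (cl-mono (p⊆q⇒p-x⊆q-x C⊆I) (circuit-∈cl circ e∈C))

  ∈cl⇒circuit : x ∈ cl M X → x ∉ X → ∃[ C ] (Circuit M C × x ∈ C × C ⊆ X ∪ ⁅ x ⁆)
  ∈cl⇒circuit {x} {X} x∈clX x∉X = from-basis (basis X)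
    where
    from-basis : ∃[ I ] (I ⊆ X × ¬ Dependent M I × r I ≡ r X) →
                 ∃[ C ] (Circuit M C × x ∈ C × C ⊆ X ∪ ⁅ x ⁆)
    from-basis (I , I⊆X , independent , r[I]≡r[X]) with dependent⇒circuit⊆ dependent
      where
      open ≤-Reasoning
      I#x : Disjoint I ⁅ x ⁆
      I#x y∈I y∈⁅x⁆ = x∉X (subst (_∈ X) (x∈⁅y⁆⇒x≡y x y∈⁅x⁆) (I⊆X y∈I))
      dependent : Dependent M (I ∪ ⁅ x ⁆)
      dependent = begin-strict
        r (I ∪ ⁅ x ⁆)        ≤⟨ r-mono (∪-mono I⊆X ⊆-refl) ⟩
        r (X ∪ ⁅ x ⁆)        ≡⟨ ∈cl⁻ x∈clX ⟩
        r X                  ≡⟨ sym r[I]≡r[X] ⟩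
        r I                  ≤⟨ r-bounded I ⟩
        ∣ I ∣                <⟨ n<1+n ∣ I ∣ ⟩
        suc ∣ I ∣            ≡⟨ +-comm 1 ∣ I ∣ ⟩
        ∣ I ∣ + 1            ≡⟨ cong (∣ I ∣ +_) (sym (∣⁅x⁆∣≡1 x)) ⟩
        ∣ I ∣ + ∣ ⁅ x ⁆ ∣    ≡⟨ sym (∣p∪q∣≡∣p∣+∣q∣ I#x) ⟩
        ∣ I ∪ ⁅ x ⁆ ∣        ∎
    ... | C , C⊆I∪x , circ with x ∈? C
    ... | yes x∈C = C , circ , x∈C , ⊆-trans C⊆I∪x (∪-mono I⊆X ⊆-refl)
    ... | no x∉C = ⊥-elim (independent (dependent-⊇ C⊆I (proj₁ circ)))
      where
      C⊆I : C ⊆ I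
      C⊆I y∈C with x∈p∪q⁻ I ⁅ x ⁆ (C⊆I∪x y∈C)
      ... | inj₁ y∈I = y∈I
      ... | inj₂ y∈⁅x⁆ = ⊥-elim (x∉C (subst (_∈ C) (x∈⁅y⁆⇒x≡y x y∈⁅x⁆) y∈C))

  circuit-elim : Circuit M C₁ → Circuit M C₂ → b ∈ C₁ → b ∈ C₂ → a ∈ C₁ → a ∉ C₂ →
                 ∃[ C ] (Circuit M C × a ∈ C × C ⊆ (C₁ ∪ C₂) - b)
  circuit-elim {C₁} {C₂} {b} {a} circ₁ circ₂ b∈C₁ b∈C₂ a∈C₁ a∉C₂ =
    let (C , circ , a∈C , C⊆W∪a) = ∈cl⇒circuit a∈clW a∉W
    in C , circ , a∈C , ⊆-trans C⊆W∪a (∪-lub (p─q⊆p _ _) (⁅x⁆⊆p a∈[C₁∪C₂]-b))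
    where
    W : Subset n
    W = ((C₁ ∪ C₂) - b) - a
    a∈[C₁∪C₂]-b : a ∈ (C₁ ∪ C₂) - b
    a∈[C₁∪C₂]-b = x∈p∧x≢y⇒x∈p-y (p⊆p∪q C₂ a∈C₁) (λ { refl → a∉C₂ b∈C₂ })
    a∉W : a ∉ W
    a∉W a∈W = proj₂ (x∈p-y⁻ a∈W) refl
    C₂-b⊆W : C₂ - b ⊆ W
    C₂-b⊆W = p⊆q∧x∉p⇒p⊆q-x (p⊆q⇒p-x⊆q-x (q⊆p∪q C₁ C₂)) (a∉C₂ ∘ p─q⊆p C₂ _)
    C₁-a⊆W∪b : C₁ - a ⊆ W ∪ ⁅ b ⁆
    C₁-a⊆W∪b {y} y∈C₁-a with y ≟ᶠ b
    ... | yes refl = q⊆p∪q W ⁅ y ⁆ (x∈⁅x⁆ y)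
    ... | no y≢b = let (y∈C₁ , y≢a) = x∈p-y⁻ y∈C₁-a in
      p⊆p∪q ⁅ b ⁆ (x∈p∧x≢y⇒x∈p-y (x∈p∧x≢y⇒x∈p-y (p⊆p∪q C₂ y∈C₁) y≢b) y≢a)
    b∈clW : b ∈ cl M W
    b∈clW = cl-mono C₂-b⊆W (circuit-∈cl circ₂ b∈C₂)
    a∈clW : a ∈ cl M W
    a∈clW = cl-⊆ (∪-lub X⊆clX (⁅x⁆⊆p b∈clW)) (cl-mono C₁-a⊆W∪b (circuit-∈cl circ₁ a∈C₁))

  circuit-⊈ : Circuit M C → Circuit M C₁ → C ⊆ (C₁ ∪ C₂) - b → b ∈ C₁ →
              ∃[ x ] (x ∈ C × x ∈ C₂ × x ∉ C₁)
  circuit-⊈ {C} {C₁} {C₂} {b} circ circ₁ C⊆ b∈C₁ with ⊈⇒∃∉ C⊈C₁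
    where
    C⊈C₁ : ¬ (C ⊆ C₁)
    C⊈C₁ C⊆C₁ = proj₂ (x∈p-y⁻ (C⊆ (circuit-⊆⇒⊇ circ circ₁ C⊆C₁ b∈C₁))) refl
  ... | x , x∈C , x∉C₁ = x , x∈C , [ ⊥-elim ∘ x∉C₁ , id ]′ (x∈p∪q⁻ C₁ C₂ (p─q⊆p _ _ (C⊆ x∈C))) , x∉C₁

  -- Induction on ∣ C₁ ∪ C₂ ∣: eliminating b from both circuits gives circuits C₃ ∋ a and C₄ ∋ c
  -- inside (C₁ ∪ C₂) - b, and either C₃, C₄ or C₁, C₄ is a smaller pair of circuits that meet.
  circuit-trans : Circuit M C₁ → Circuit M C₂ → a ∈ C₁ → b ∈ C₁ → b ∈ C₂ → c ∈ C₂ →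
                  ∃[ C ] (Circuit M C × C ⊆ C₁ ∪ C₂ × a ∈ C × c ∈ C)
  circuit-trans {C₁} {C₂} = go C₁ C₂ (<-wellFounded _)
    where
    Linked : Subset n → Fin n → Fin n → Set
    Linked U a c = ∃[ C ] (Circuit M C × C ⊆ U × a ∈ C × c ∈ C)

    go : ∀ C₁ C₂ {a b c} → Acc _<_ ∣ C₁ ∪ C₂ ∣ → Circuit M C₁ → Circuit M C₂ →
         a ∈ C₁ → b ∈ C₁ → b ∈ C₂ → c ∈ C₂ → Linked (C₁ ∪ C₂) a c
    go C₁ C₂ {a} {b} {c} (acc smaller) circ₁ circ₂ a∈C₁ b∈C₁ b∈C₂ c∈C₂ with c ∈? C₁ | a ∈? C₂
    ... | yes c∈C₁ | _ = C₁ , circ₁ , p⊆p∪q C₂ , a∈C₁ , c∈C₁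
    ... | no _ | yes a∈C₂ = C₂ , circ₂ , q⊆p∪q C₁ C₂ , a∈C₂ , c∈C₂
    ... | no c∉C₁ | no a∉C₂ = eliminate (circuit-elim circ₁ circ₂ b∈C₁ b∈C₂ a∈C₁ a∉C₂)
                                        (circuit-elim circ₂ circ₁ b∈C₂ b∈C₁ c∈C₂ c∉C₁)
      where
      recurse : ∀ {C₃ C₄ h} → C₃ ∪ C₄ ⊂ C₁ ∪ C₂ → Circuit M C₃ → Circuit M C₄ →
                a ∈ C₃ → h ∈ C₃ → h ∈ C₄ → c ∈ C₄ → Linked (C₁ ∪ C₂) a c
      recurse C₃∪C₄⊂ circ₃ circ₄ a∈C₃ h∈C₃ h∈C₄ c∈C₄ =
        let (C , circ , C⊆C₃∪C₄ , a∈C , c∈C) =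
              go _ _ (smaller (p⊂q⇒∣p∣<∣q∣ C₃∪C₄⊂)) circ₃ circ₄ a∈C₃ h∈C₃ h∈C₄ c∈C₄
        in C , circ , ⊆-trans C⊆C₃∪C₄ (proj₁ C₃∪C₄⊂) , a∈C , c∈C
      [C₂∪C₁]-b⊆C₁∪C₂ : (C₂ ∪ C₁) - b ⊆ C₁ ∪ C₂
      [C₂∪C₁]-b⊆C₁∪C₂ = ∪-lub (q⊆p∪q C₁ C₂) (p⊆p∪q C₂) ∘ p─q⊆p _ _
      eliminate : ∃[ C ] (Circuit M C × a ∈ C × C ⊆ (C₁ ∪ C₂) - b) →
                  ∃[ C ] (Circuit M C × c ∈ C × C ⊆ (C₂ ∪ C₁) - b) → Linked (C₁ ∪ C₂) a c
      eliminate (C₃ , circ₃ , a∈C₃ , C₃⊆) (C₄ , circ₄ , c∈C₄ , C₄⊆) with (C₂ ─ C₁) ⊆? C₄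
      ... | yes C₂─C₁⊆C₄ =
        let (h , h∈C₃ , h∈C₂ , h∉C₁) = circuit-⊈ circ₃ circ₁ C₃⊆ b∈C₁
        in recurse C₃∪C₄⊂ circ₃ circ₄ a∈C₃ h∈C₃ (C₂─C₁⊆C₄ (x∈p∧x∉q⇒x∈p─q h∈C₂ h∉C₁)) c∈C₄
        where
        C₃∪C₄⊂ : C₃ ∪ C₄ ⊂ C₁ ∪ C₂
        C₃∪C₄⊂ = ∪-lub (p─q⊆p _ _ ∘ C₃⊆) ([C₂∪C₁]-b⊆C₁∪C₂ ∘ C₄⊆) , b , p⊆p∪q C₂ b∈C₁ ,
                 x∉p∧x∉q⇒x∉p∪q (λ b∈C₃ → proj₂ (x∈p-y⁻ (C₃⊆ b∈C₃)) refl)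
                                (λ b∈C₄ → proj₂ (x∈p-y⁻ (C₄⊆ b∈C₄)) refl)
      ... | no C₂─C₁⊈C₄ =
        let (w , w∈C₄ , w∈C₁ , _) = circuit-⊈ circ₄ circ₂ C₄⊆ b∈C₂
            (x , x∈C₂─C₁ , x∉C₄) = ⊈⇒∃∉ C₂─C₁⊈C₄
            (x∈C₂ , x∉C₁) = x∈p─q⁻ x∈C₂─C₁
            C₁∪C₄⊂ : C₁ ∪ C₄ ⊂ C₁ ∪ C₂
            C₁∪C₄⊂ = ∪-lub (p⊆p∪q C₂) ([C₂∪C₁]-b⊆C₁∪C₂ ∘ C₄⊆) , x , q⊆p∪q C₁ C₂ x∈C₂ ,
                     x∉p∧x∉q⇒x∉p∪q x∉C₁ x∉C₄
        in recurse C₁∪C₄⊂ circ₁ circ₄ a∈C₁ w∈C₁ w∈C₄ c∈C₄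

  -- Skew sets and components

  Skew : Subset n → Subset n → Set
  Skew X Y = r (X ∪ Y) ≡ r X + r Y

  skew-sym : Skew X Y → Skew Y X
  skew-sym {X} {Y} skew = trans (cong r (∪-comm Y X)) (trans skew (+-comm (r X) (r Y)))

  skew-⊆ˡ : X′ ⊆ X → Skew X Y → Skew X′ Y
  skew-⊆ˡ {X′} {X} {Y} X′⊆X skew = ≤-antisym (r-∪≤ X′ Y) (+-cancelˡ-≤ (r X) _ _ (begin
    r X + (r X′ + r Y)    ≡⟨ x∙yz≈xz∙y (r X) (r X′) (r Y) ⟩
    (r X + r Y) + r X′    ≡⟨ cong (_+ r X′) (sym skew) ⟩
    r (X ∪ Y) + r X′      ≤⟨ r-submod-⊆ (∪-lub (q⊆p∪q _ X) (p⊆p∪q X ∘ q⊆p∪q X′ Y))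
                                        (λ z∈X′ → x∈p∩q⁺ (p⊆p∪q Y z∈X′ , X′⊆X z∈X′)) ⟩
    r (X′ ∪ Y) + r X      ≡⟨ +-comm _ (r X) ⟩
    r X + r (X′ ∪ Y)      ∎))
    where open ≤-Reasoning

  skew-⊆ : X′ ⊆ X → Y′ ⊆ Y → Skew X Y → Skew X′ Y′
  skew-⊆ X′⊆X Y′⊆Y = skew-sym ∘ skew-⊆ˡ Y′⊆Y ∘ skew-sym ∘ skew-⊆ˡ X′⊆X

  skew-⊆cl : X′ ⊆ cl M X → Y′ ⊆ cl M Y → Skew X Y → Skew X′ Y′
  skew-⊆cl {X′} {X} {Y′} {Y} X′⊆ Y′⊆ skew = skew-⊆ X′⊆ Y′⊆ (≤-antisym (r-∪≤ _ _) (begin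
    r (cl M X) + r (cl M Y)    ≡⟨ cong₂ _+_ (r-cl X) (r-cl Y) ⟩
    r X + r Y                  ≡⟨ sym skew ⟩
    r (X ∪ Y)                  ≤⟨ r-mono (∪-mono X⊆clX X⊆clX) ⟩
    r (cl M X ∪ cl M Y)        ∎))
    where open ≤-Reasoning

  separator⇒skew : Disjoint X Y → (∀ C → Circuit M C → C ⊆ X ∪ Y → C ⊆ X ⊎ C ⊆ Y) → Skew X Y
  separator⇒skew {X} {Y} X#Y separates with r (X ∪ Y) ≟ r X + r Y
  ... | yes skew = skew
  ... | no ¬skew = from-bases (basis X) (basis Y)
    where
    from-bases : ∃[ I ] (I ⊆ X × ¬ Dependent M I × r I ≡ r X) →
                 ∃[ J ] (J ⊆ Y × ¬ Dependent M J × r J ≡ r Y) → Skew X Y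
    from-bases (I , I⊆X , independentI , r[I]≡r[X]) (J , J⊆Y , independentJ , r[J]≡r[Y])
      with dependent⇒circuit⊆ dependent
      where
      open ≤-Reasoning
      dependent : Dependent M (I ∪ J)
      dependent = begin-strict
        r (I ∪ J)          ≤⟨ r-mono (∪-mono I⊆X J⊆Y) ⟩
        r (X ∪ Y)          <⟨ ≤∧≢⇒< (r-∪≤ X Y) ¬skew ⟩
        r X + r Y          ≡⟨ sym (cong₂ _+_ r[I]≡r[X] r[J]≡r[Y]) ⟩
        r I + r J          ≤⟨ +-mono-≤ (r-bounded I) (r-bounded J) ⟩
        ∣ I ∣ + ∣ J ∣      ≡⟨ sym (∣p∪q∣≡∣p∣+∣q∣ (λ z∈I z∈J → X#Y (I⊆X z∈I) (J⊆Y z∈J))) ⟩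
        ∣ I ∪ J ∣          ∎
    ... | C , C⊆I∪J , circ with separates C circ (⊆-trans C⊆I∪J (∪-mono I⊆X J⊆Y))
    ... | inj₁ C⊆X = ⊥-elim (independentI (dependent-⊇ C⊆I (proj₁ circ)))
      where
      C⊆I : C ⊆ I
      C⊆I z∈C = [ id , (λ z∈J → ⊥-elim (X#Y (C⊆X z∈C) (J⊆Y z∈J))) ]′ (x∈p∪q⁻ I J (C⊆I∪J z∈C))
    ... | inj₂ C⊆Y = ⊥-elim (independentJ (dependent-⊇ C⊆J (proj₁ circ)))
      where
      C⊆J : C ⊆ J
      C⊆J z∈C = [ (λ z∈I → ⊥-elim (X#Y (I⊆X z∈I) (C⊆Y z∈C))) , id ]′ (x∈p∪q⁻ I J (C⊆I∪J z∈C))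

  Related-sym : Related M D a b → Related M D b a
  Related-sym (inj₁ refl) = inj₁ refl
  Related-sym (inj₂ (C , circ , C⊆D , a∈C , b∈C)) = inj₂ (C , circ , C⊆D , b∈C , a∈C)

  Related-trans : Related M D a b → Related M D b c → Related M D a c
  Related-trans (inj₁ refl) b~c = b~c
  Related-trans a~b (inj₁ refl) = a~b
  Related-trans (inj₂ (C₁ , circ₁ , C₁⊆D , a∈C₁ , b∈C₁)) (inj₂ (C₂ , circ₂ , C₂⊆D , b∈C₂ , c∈C₂)) =
    let (C , circ , C⊆C₁∪C₂ , a∈C , c∈C) = circuit-trans circ₁ circ₂ a∈C₁ b∈C₁ b∈C₂ c∈C₂
    in inj₂ (C , circ , ⊆-trans C⊆C₁∪C₂ (∪-lub C₁⊆D C₂⊆D) , a∈C , c∈C)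

  Related⇒∈ : a ∈ D → Related M D a b → b ∈ D
  Related⇒∈ a∈D (inj₁ refl) = a∈D
  Related⇒∈ _ (inj₂ (C , _ , C⊆D , _ , b∈C)) = C⊆D b∈C

  circuit? : Decidable (Circuit M)
  circuit? C with dependent? C | anySubset? (λ X → X ⊂? C ×-dec dependent? X)
  ... | no independent | _ = no (independent ∘ proj₁)
  ... | yes _ | yes (X , X⊂C , depX) = no (λ circ → proj₂ circ X X⊂C depX)
  ... | yes depC | no none = yes (depC , λ X X⊂C depX → none (X , X⊂C , depX))

  related? : ∀ D a b → Dec (Related M D a b)
  related? D a b =
    (a ≟ᶠ b) ⊎-dec anySubset? (λ C → circuit? C ×-dec C ⊆? D ×-dec a ∈? C ×-dec b ∈? C)

  component : Subset n → Fin n → Subset n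
  component D x = tabulate (λ y → isYes (y ∈? D ×-dec related? D x y))

  ∈component⁻ : y ∈ component D x → y ∈ D × Related M D x y
  ∈component⁻ {y} {D} {x} y∈ = toWitness {a? = y ∈? D ×-dec related? D x y} (x∈tabulate⁻ y∈)

  ∈component⁺ : y ∈ D → Related M D x y → y ∈ component D x
  ∈component⁺ {y} {D} {x} y∈D x~y =
    x∈tabulate⁺ (fromWitness {a? = y ∈? D ×-dec related? D x y} (y∈D , x~y))

  component-isComponent : x ∈ D → IsComponent M D (component D x)
  component-isComponent x∈D = _ , x∈D , λ y → mk⇔ ∈component⁻ (uncurry ∈component⁺)

  component-separator : ∀ C → Circuit M C → C ⊆ component D x ∪ R → R ⊆ D →
                        C ⊆ component D x ⊎ C ⊆ R
  component-separator {D} {x} {R} C circ C⊆ R⊆D with nonempty? (C ∩ component D x)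
  ... | yes (g , g∈C∩Dₓ) = inj₁ (λ z∈C → ∈component⁺ (C⊆D z∈C)
                              (Related-trans x~g (inj₂ (C , circ , C⊆D , g∈C , z∈C))))
    where
    g∈C = proj₁ (x∈p∩q⁻ C _ g∈C∩Dₓ)
    x~g = proj₂ (∈component⁻ (proj₂ (x∈p∩q⁻ C _ g∈C∩Dₓ)))
    C⊆D : C ⊆ D
    C⊆D = ⊆-trans C⊆ (∪-lub (proj₁ ∘ ∈component⁻) R⊆D)
  ... | no C∩Dₓ≡∅ = inj₂ (λ {z} z∈C →
        [ (λ z∈Dₓ → ⊥-elim (C∩Dₓ≡∅ (z , x∈p∩q⁺ (z∈C , z∈Dₓ)))) , id ]′ (x∈p∪q⁻ _ R (C⊆ z∈C)))

  -- Fold circuits and principal partitions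

  foldCircuit⇒nullity : FoldCircuit M k D → nullity D ≡ k
  foldCircuit⇒nullity (_ , eq) = nullity-unique eq

  nullity⇒foldCircuit : Cyclic M D → nullity D ≡ k → FoldCircuit M k D
  nullity⇒foldCircuit {D} cyc refl = cyc , r+nullity≡∣∣ D

  foldCircuit-unique : FoldCircuit M j D → FoldCircuit M k D → j ≡ k
  foldCircuit-unique D-fold D-fold′ = trans (sym (foldCircuit⇒nullity D-fold)) (foldCircuit⇒nullity D-fold′)

  predFoldCircuit⇒nullity : PredFoldCircuit M k B → suc (nullity B) ≡ k
  predFoldCircuit⇒nullity {k} {B} (_ , eq) = +-cancelˡ-≡ (r B) _ _ (begin
    r B + suc (nullity B)    ≡⟨ +-suc (r B) _ ⟩
    suc (r B + nullity B)    ≡⟨ cong suc (r+nullity≡∣∣ B) ⟩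
    suc ∣ B ∣                ≡⟨ sym eq ⟩
    r B + k                  ∎)
    where open ≡-Reasoning

  nullity⇒predFoldCircuit : Cyclic M B → suc (nullity B) ≡ k → PredFoldCircuit M k B
  nullity⇒predFoldCircuit {B} cyc refl = cyc , trans (+-suc (r B) _) (cong suc (r+nullity≡∣∣ B))

  cyclic⇒∈cl : Cyclic M X → x ∈ X → x ∈ cl M (X - x)
  cyclic⇒∈cl cyc x∈X = r[X-x]≡r[X]⇒∈cl[X-x] x∈X (cyc _ x∈X)

  cyclic-∪ : Cyclic M X → Cyclic M Y → Cyclic M (X ∪ Y)
  cyclic-∪ {X} {Y} cycX cycY e e∈X∪Y = ∈cl[X-x]⇒r[X-x]≡r[X] e∈X∪Y
    ([ via cycX (p⊆p∪q Y) , via cycY (q⊆p∪q X Y) ]′ (x∈p∪q⁻ X Y e∈X∪Y))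
    where
    via : ∀ {Z} → Cyclic M Z → Z ⊆ X ∪ Y → e ∈ Z → e ∈ cl M ((X ∪ Y) - e)
    via cycZ Z⊆ e∈Z = cl-mono (p⊆q⇒p-x⊆q-x Z⊆) (cyclic⇒∈cl cycZ e∈Z)

  nullity≡1+nullity[X-x] : Cyclic M X → x ∈ X → nullity X ≡ suc (nullity (X - x))
  nullity≡1+nullity[X-x] {X} {x} cyc x∈X = nullity-unique (begin
    r X + suc (nullity (X - x))          ≡⟨ +-suc (r X) _ ⟩
    suc (r X + nullity (X - x))          ≡⟨ cong (λ s → suc (s + nullity (X - x))) (sym (cyc x x∈X)) ⟩
    suc (r (X - x) + nullity (X - x))    ≡⟨ cong suc (r+nullity≡∣∣ (X - x)) ⟩
    suc ∣ X - x ∣                        ≡⟨ sym (∣p∣≡1+∣p-x∣ x∈X) ⟩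
    ∣ X ∣                                ∎)
    where open ≡-Reasoning

  nullity[X-x]≡nullity[X] : x ∈ X → r (X - x) ≢ r X → nullity (X - x) ≡ nullity X
  nullity[X-x]≡nullity[X] {x} {X} x∈X r≢ = sym (nullity-unique (begin
    r X + nullity (X - x)                ≡⟨ cong (_+ nullity (X - x)) r[X]≡ ⟩
    suc (r (X - x) + nullity (X - x))    ≡⟨ cong suc (r+nullity≡∣∣ (X - x)) ⟩
    suc ∣ X - x ∣                        ≡⟨ sym (∣p∣≡1+∣p-x∣ x∈X) ⟩
    ∣ X ∣                                ∎))
    where
    open ≡-Reasoning
    r[X]≡ : r X ≡ suc (r (X - x))
    r[X]≡ = ≤-antisym (r≤1+r[X-x] x∈X) (≤∧≢⇒< (r-mono (p─q⊆p X _)) r≢)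

  cyclic-⊆ : Cyclic M X → Y ⊆ X → nullity X ≤ nullity Y → X ⊆ Y
  cyclic-⊆ {X} {Y} cyc Y⊆X ν[X]≤ν[Y] {x} x∈X with x ∈? Y
  ... | yes x∈Y = x∈Y
  ... | no x∉Y = ⊥-elim (<-irrefl refl (begin-strict
    nullity Y          ≤⟨ nullity-mono (p⊆q∧x∉p⇒p⊆q-x Y⊆X x∉Y) ⟩
    nullity (X - x)    <⟨ ≤-reflexive (sym (nullity≡1+nullity[X-x] cyc x∈X)) ⟩
    nullity X          ≤⟨ ν[X]≤ν[Y] ⟩
    nullity Y          ∎))
    where open ≤-Reasoning

  cyclic-core : ∀ X → ∃[ Y ] (Y ⊆ X × Cyclic M Y × nullity Y ≡ nullity X)
  cyclic-core X with ⊆-minimal {P = λ Y → nullity Y ≡ nullity X} (λ Y → nullity Y ≟ nullity X) refl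
  ... | Y , Y⊆X , ν≡ , minimal = Y , Y⊆X , cyclic , ν≡
    where
    cyclic : Cyclic M Y
    cyclic e e∈Y with r (Y - e) ≟ r Y
    ... | yes r≡ = r≡
    ... | no r≢ = ⊥-elim (minimal (Y - e) (x∈p⇒p-x⊂p e∈Y) (trans (nullity[X-x]≡nullity[X] e∈Y r≢) ν≡))

  foldCircuit-avoiding : FoldCircuit M k D → x ∈ D →
                         ∃[ B ] (B ⊆ D × PredFoldCircuit M k B × x ∉ B)
  foldCircuit-avoiding {k} {D} {x} D-fold@(cycD , _) x∈D with cyclic-core (D - x)
  ... | B , B⊆D-x , cycB , ν≡ =
    B , p─q⊆p D _ ∘ B⊆D-x , nullity⇒predFoldCircuit cycB 1+ν≡k , λ x∈B → proj₂ (x∈p-y⁻ (B⊆D-x x∈B)) refl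
    where
    1+ν≡k : suc (nullity B) ≡ k
    1+ν≡k = trans (cong suc ν≡) (trans (sym (nullity≡1+nullity[X-x] cycD x∈D)) (foldCircuit⇒nullity D-fold))

  predFoldCircuit-⊆ : FoldCircuit M k D → B ⊆ D → B′ ⊆ D →
                      PredFoldCircuit M k B → PredFoldCircuit M k B′ → x ∈ D → x ∉ B → x ∉ B′ → B ⊆ B′
  predFoldCircuit-⊆ {k} {D} {B} {B′} {x} D-fold@(cycD , _) B⊆D B′⊆D B-pred B′-pred x∈D x∉B x∉B′ =
    cyclic-⊆ (cyclic-∪ (proj₁ B-pred) (proj₁ B′-pred)) (q⊆p∪q B B′) (begin
      nullity (B ∪ B′)         ≤⟨ nullity-mono (p⊆q∧x∉p⇒p⊆q-x (∪-lub B⊆D B′⊆D) (x∉p∧x∉q⇒x∉p∪q x∉B x∉B′)) ⟩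
      nullity (D - x)          ≡⟨ suc-injective (begin-equality
        suc (nullity (D - x))    ≡⟨ sym (nullity≡1+nullity[X-x] cycD x∈D) ⟩
        nullity D                ≡⟨ foldCircuit⇒nullity D-fold ⟩
        k                        ≡⟨ sym (predFoldCircuit⇒nullity B′-pred) ⟩
        suc (nullity B′)         ∎) ⟩
      nullity B′               ∎)
    ∘ p⊆p∪q B′
    where open ≤-Reasoning

  ⋂cl : Subset n → List (Subset n) → Subset n
  ⋂cl D As = ⋂ M (map (λ A → cl M (D ─ A)) As)

  ⋂cl⊆ : A ∈ₗ As → ⋂cl D As ⊆ cl M (D ─ A)
  ⋂cl⊆ (here refl) x∈ = proj₁ (x∈p∩q⁻ _ _ x∈)
  ⋂cl⊆ (there A∈As) x∈ = ⋂cl⊆ A∈As (proj₂ (x∈p∩q⁻ _ _ x∈))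

  ∈⋂cl⁺ : (∀ {A} → A ∈ₗ As → x ∈ cl M (D ─ A)) → x ∈ ⋂cl D As
  ∈⋂cl⁺ {As = []} _ = ∈⊤
  ∈⋂cl⁺ {As = A ∷ As} x∈all = x∈p∩q⁺ (x∈all (here refl) , ∈⋂cl⁺ (x∈all ∘ there))

  module PrincipalPartition {k D As} (D-fold : FoldCircuit M k D)
                            (enum : EnumeratesPrincipalPartition M k D As) where

    piece⁻ : A ∈ₗ As → ∃[ B ] (B ⊆ D × PredFoldCircuit M k B × A ≡ D ─ B)
    piece⁻ = Equivalence.to (proj₂ enum _)

    piece⁺ : B ⊆ D → PredFoldCircuit M k B → D ─ B ∈ₗ As
    piece⁺ B⊆D B-pred = Equivalence.from (proj₂ enum _) (_ , B⊆D , B-pred , refl)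

    piece-⊆ : A ∈ₗ As → A ⊆ D
    piece-⊆ A∈As with piece⁻ A∈As
    ... | B , _ , _ , refl = p─q⊆p D B

    pieces-cover : x ∈ D → ∃[ A ] (A ∈ₗ As × x ∈ A)
    pieces-cover x∈D with foldCircuit-avoiding D-fold x∈D
    ... | B , B⊆D , B-pred , x∉B = D ─ B , piece⁺ B⊆D B-pred , x∈p∧x∉q⇒x∈p─q x∈D x∉B

    pieces-disjoint : A ∈ₗ As → B ∈ₗ As → A ≢ B → Disjoint A B
    pieces-disjoint A∈As A′∈As A≢A′ x∈A x∈A′ with piece⁻ A∈As | piece⁻ A′∈As
    ... | B , B⊆D , B-pred , refl | B′ , B′⊆D , B′-pred , refl =
      A≢A′ (cong (D ─_) (⊆-antisym (predFoldCircuit-⊆ D-fold B⊆D B′⊆D B-pred B′-pred x∈D x∉B x∉B′)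
                                   (predFoldCircuit-⊆ D-fold B′⊆D B⊆D B′-pred B-pred x∈D x∉B′ x∉B)))
      where
      x∈D = proj₁ (x∈p─q⁻ x∈A)
      x∉B = proj₂ (x∈p─q⁻ x∈A)
      x∉B′ = proj₂ (x∈p─q⁻ x∈A′)

    r[D─A]+∣A∣≡1+r[D] : A ∈ₗ As → r (D ─ A) + ∣ A ∣ ≡ suc (r D)
    r[D─A]+∣A∣≡1+r[D] A∈As with piece⁻ A∈As
    ... | B , B⊆D , (_ , r[B]+k≡) , refl = +-cancelʳ-≡ k _ _ (begin
      r (D ─ (D ─ B)) + ∣ D ─ B ∣ + k   ≡⟨ cong (λ Z → r Z + ∣ D ─ B ∣ + k) (p─[p─q]≡q B⊆D) ⟩
      r B + ∣ D ─ B ∣ + k               ≡⟨ xy∙z≈xz∙y (r B) ∣ D ─ B ∣ k ⟩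
      r B + k + ∣ D ─ B ∣               ≡⟨ cong (_+ ∣ D ─ B ∣) r[B]+k≡ ⟩
      suc (∣ B ∣ + ∣ D ─ B ∣)           ≡⟨ cong suc (sym (∣q∣≡∣p∣+∣q─p∣ B⊆D)) ⟩
      suc ∣ D ∣                         ≡⟨ cong suc (sym (proj₂ D-fold)) ⟩
      suc (r D + k)                     ∎)
      where open ≡-Reasoning

    piece-nonempty : A ∈ₗ As → Nonempty A
    piece-nonempty {A} A∈As with nonempty? A
    ... | yes nonempty = nonempty
    ... | no empty = ⊥-elim (<⇒≱ r[D]<r[D─A] (r-mono (p─q⊆p D A)))
      where
      open ≡-Reasoning
      r[D]<r[D─A] : r D < r (D ─ A)
      r[D]<r[D─A] = ≤-reflexive (begin
        suc (r D)            ≡⟨ sym (r[D─A]+∣A∣≡1+r[D] A∈As) ⟩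
        r (D ─ A) + ∣ A ∣    ≡⟨ cong (r (D ─ A) +_) (trans (cong ∣_∣ (Empty-unique empty)) (∣⊥∣≡0 n)) ⟩
        r (D ─ A) + 0        ≡⟨ +-identityʳ _ ⟩
        r (D ─ A)            ∎)

    r[cl[D─A]∩Q]+∣A∣≤1+r[Q] : ∀ {Q} → A ∈ₗ As → A ⊆ Q → r (cl M (D ─ A) ∩ Q) + ∣ A ∣ ≤ suc (r Q)
    r[cl[D─A]∩Q]+∣A∣≤1+r[Q] {A} {Q} A∈As A⊆Q = +-cancelˡ-≤ (r D) _ _ (begin
      r D + (r (F ∩ Q) + ∣ A ∣)    ≡⟨ sym (+-assoc (r D) _ _) ⟩
      r D + r (F ∩ Q) + ∣ A ∣      ≤⟨ +-monoˡ-≤ ∣ A ∣ (r-submod-⊆ D⊆F∪Q ⊆-refl) ⟩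
      r F + r Q + ∣ A ∣            ≡⟨ cong (λ s → s + r Q + ∣ A ∣) (r-cl (D ─ A)) ⟩
      r (D ─ A) + r Q + ∣ A ∣      ≡⟨ xy∙z≈xz∙y (r (D ─ A)) (r Q) ∣ A ∣ ⟩
      r (D ─ A) + ∣ A ∣ + r Q      ≡⟨ cong (_+ r Q) (r[D─A]+∣A∣≡1+r[D] A∈As) ⟩
      suc (r D) + r Q              ≡⟨ sym (+-suc (r D) (r Q)) ⟩
      r D + suc (r Q)              ∎)
      where
      open ≤-Reasoning
      F = cl M (D ─ A)
      D⊆F∪Q : D ⊆ F ∪ Q
      D⊆F∪Q {x} x∈D with x ∈? A
      ... | yes x∈A = q⊆p∪q F Q (A⊆Q x∈A)
      ... | no x∉A = p⊆p∪q Q (X⊆clX (x∈p∧x∉q⇒x∈p─q x∈D x∉A))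

    r[⋂cl]+Σ∣A∣≤r[D]+ℓ : ∀ L → L ⊆ₗ As → Unique L → A ∈ₗ L →
                         r (⋂cl D L) + sum (map ∣_∣ L) ≤ r D + length L
    r[⋂cl]+Σ∣A∣≤r[D]+ℓ (A ∷ []) L⊆As _ _ = ≤-reflexive (begin
      r (cl M (D ─ A) ∩ ⊤) + (∣ A ∣ + 0)   ≡⟨ cong₂ _+_ (trans (cong r (∩-identityʳ _)) (r-cl (D ─ A)))
                                                          (+-identityʳ ∣ A ∣) ⟩
      r (D ─ A) + ∣ A ∣                    ≡⟨ r[D─A]+∣A∣≡1+r[D] (L⊆As (here refl)) ⟩
      suc (r D)                            ≡⟨ +-comm 1 (r D) ⟩
      r D + 1                              ∎)
      where open ≡-Reasoning
    r[⋂cl]+Σ∣A∣≤r[D]+ℓ (A ∷ L@(_ ∷ _)) L⊆As (A∉L ∷ uniqueL) _ = begin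
      r (F ∩ Q) + (∣ A ∣ + Σ)    ≡⟨ sym (+-assoc (r (F ∩ Q)) _ _) ⟩
      r (F ∩ Q) + ∣ A ∣ + Σ      ≤⟨ +-monoˡ-≤ Σ (r[cl[D─A]∩Q]+∣A∣≤1+r[Q] A∈As A⊆Q) ⟩
      suc (r Q + Σ)              ≤⟨ s≤s (r[⋂cl]+Σ∣A∣≤r[D]+ℓ L (L⊆As ∘ there) uniqueL (here refl)) ⟩
      suc (r D + length L)       ≡⟨ sym (+-suc (r D) _) ⟩
      r D + length (A ∷ L)       ∎
      where
      open ≤-Reasoning
      F = cl M (D ─ A)
      Q = ⋂cl D L
      Σ = sum (map ∣_∣ L)
      A∈As = L⊆As (here refl)
      A⊆Q : A ⊆ Q
      A⊆Q x∈A = ∈⋂cl⁺ (λ A′∈L → X⊆clX (x∈p∧x∉q⇒x∈p─q (piece-⊆ A∈As x∈A)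
        (pieces-disjoint A∈As (L⊆As (there A′∈L)) (All.lookup A∉L A′∈L) x∈A)))

    r[⋂cl]+k≤ℓ : Nonempty D → r (⋂cl D As) + k ≤ length As
    r[⋂cl]+k≤ℓ (x , x∈D) = +-cancelˡ-≤ (r D) _ _ (begin
      r D + (r (⋂cl D As) + k)           ≡⟨ x∙yz≈y∙xz (r D) _ k ⟩
      r (⋂cl D As) + (r D + k)           ≡⟨ cong (r (⋂cl D As) +_) (proj₂ D-fold) ⟩
      r (⋂cl D As) + ∣ D ∣               ≤⟨ +-monoʳ-≤ _ (≤-trans (p⊆q⇒∣p∣≤∣q∣ D⊆⋃As) (∣⋃∣≤Σ∣∣ As)) ⟩
      r (⋂cl D As) + sum (map ∣_∣ As)    ≤⟨ r[⋂cl]+Σ∣A∣≤r[D]+ℓ As id (proj₁ enum) A∈As ⟩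
      r D + length As                    ∎)
      where
      open ≤-Reasoning
      A∈As = proj₁ (proj₂ (pieces-cover x∈D))
      D⊆⋃As : D ⊆ ⋃ As
      D⊆⋃As y∈D = let (A , A∈As , y∈A) = pieces-cover y∈D in ∈⋃⁺ A∈As y∈A

  -- Direct sums of fold circuits

  nullity-∪ : Disjoint X Y → Skew X Y → nullity (X ∪ Y) ≡ nullity X + nullity Y
  nullity-∪ {X} {Y} X#Y skew = nullity-unique (begin
    r (X ∪ Y) + (nullity X + nullity Y)      ≡⟨ cong (_+ (nullity X + nullity Y)) skew ⟩
    (r X + r Y) + (nullity X + nullity Y)    ≡⟨ interchange (r X) (r Y) _ _ ⟩
    (r X + nullity X) + (r Y + nullity Y)    ≡⟨ cong₂ _+_ (r+nullity≡∣∣ X) (r+nullity≡∣∣ Y) ⟩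
    ∣ X ∣ + ∣ Y ∣                            ≡⟨ sym (∣p∪q∣≡∣p∣+∣q∣ X#Y) ⟩
    ∣ X ∪ Y ∣                                ∎)
    where open ≡-Reasoning

  cyclic-skew-part : Disjoint X Y → Skew X Y → Cyclic M (X ∪ Y) → Cyclic M X
  cyclic-skew-part {X} {Y} X#Y skew cyc e e∈X = +-cancelʳ-≡ (r Y) _ _ (begin
    r (X - e) + r Y      ≡⟨ sym (skew-⊆ˡ (p─q⊆p X _) skew) ⟩
    r ((X - e) ∪ Y)      ≡⟨ cong r (sym ([p∪q]-x≡[p-x]∪q (X#Y e∈X))) ⟩
    r ((X ∪ Y) - e)      ≡⟨ cyc e (p⊆p∪q Y e∈X) ⟩
    r (X ∪ Y)            ≡⟨ skew ⟩
    r X + r Y            ∎)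
    where open ≡-Reasoning

  foldCircuit-∪ : Disjoint D₁ D₂ → Skew D₁ D₂ → FoldCircuit M k₁ D₁ → FoldCircuit M k₂ D₂ →
                  FoldCircuit M (k₁ + k₂) (D₁ ∪ D₂)
  foldCircuit-∪ D₁#D₂ skew D₁-fold D₂-fold =
    nullity⇒foldCircuit (cyclic-∪ (proj₁ D₁-fold) (proj₁ D₂-fold))
      (trans (nullity-∪ D₁#D₂ skew) (cong₂ _+_ (foldCircuit⇒nullity D₁-fold) (foldCircuit⇒nullity D₂-fold)))

  predFoldCircuit-∪ˡ : Disjoint D₁ D₂ → Skew D₁ D₂ → B ⊆ D₁ →
                       PredFoldCircuit M k₁ B → FoldCircuit M k₂ D₂ →
                       PredFoldCircuit M (k₁ + k₂) (B ∪ D₂)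
  predFoldCircuit-∪ˡ D₁#D₂ skew B⊆D₁ B-pred D₂-fold =
    nullity⇒predFoldCircuit (cyclic-∪ (proj₁ B-pred) (proj₁ D₂-fold))
      (trans (cong suc (nullity-∪ (D₁#D₂ ∘ B⊆D₁) (skew-⊆ˡ B⊆D₁ skew)))
             (cong₂ _+_ (predFoldCircuit⇒nullity B-pred) (foldCircuit⇒nullity D₂-fold)))

  predFoldCircuit-∪ʳ : Disjoint D₁ D₂ → Skew D₁ D₂ → B ⊆ D₂ →
                       FoldCircuit M k₁ D₁ → PredFoldCircuit M k₂ B →
                       PredFoldCircuit M (k₁ + k₂) (D₁ ∪ B)
  predFoldCircuit-∪ʳ D₁#D₂ skew B⊆D₂ D₁-fold B-pred =
    nullity⇒predFoldCircuit (cyclic-∪ (proj₁ D₁-fold) (proj₁ B-pred))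
      (trans (cong suc (nullity-∪ (λ x∈D₁ → D₁#D₂ x∈D₁ ∘ B⊆D₂) (skew-⊆ ⊆-refl B⊆D₂ skew)))
             (trans (sym (+-suc _ _))
                    (cong₂ _+_ (foldCircuit⇒nullity D₁-fold) (predFoldCircuit⇒nullity B-pred))))

  predFoldCircuit-split : Disjoint D₁ D₂ → Skew D₁ D₂ → FoldCircuit M k₁ D₁ → FoldCircuit M k₂ D₂ →
                          B ⊆ D₁ ∪ D₂ → PredFoldCircuit M (k₁ + k₂) B →
                          ∃[ B₁ ] (B₁ ⊆ D₁ × PredFoldCircuit M k₁ B₁ × B ≡ B₁ ∪ D₂) ⊎
                          ∃[ B₂ ] (B₂ ⊆ D₂ × PredFoldCircuit M k₂ B₂ × B ≡ D₁ ∪ B₂)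
  predFoldCircuit-split {D₁} {D₂} {k₁} {k₂} {B} D₁#D₂ skew D₁-fold D₂-fold B⊆D B-pred =
    Sum.map first-part second-part (1+m+n≡j+k⇒1+m≡j⊎1+n≡k ν₁≤k₁ ν₂≤k₂ 1+ν₁+ν₂≡k₁+k₂)
    where
    B₁ = B ∩ D₁
    B₂ = B ∩ D₂
    B≡B₁∪B₂ : B ≡ B₁ ∪ B₂
    B≡B₁∪B₂ = trans (sym (p⊆q⇒p∩q≡p B⊆D)) (∩-distribˡ-∪ B D₁ D₂)
    B₁#B₂ : Disjoint B₁ B₂
    B₁#B₂ x∈B₁ x∈B₂ = D₁#D₂ (p∩q⊆q B D₁ x∈B₁) (p∩q⊆q B D₂ x∈B₂)
    skew₁₂ : Skew B₁ B₂
    skew₁₂ = skew-⊆ (p∩q⊆q B D₁) (p∩q⊆q B D₂) skew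
    cyclic₁₂ : Cyclic M (B₁ ∪ B₂)
    cyclic₁₂ = subst (Cyclic M) B≡B₁∪B₂ (proj₁ B-pred)
    1+ν₁+ν₂≡k₁+k₂ : suc (nullity B₁ + nullity B₂) ≡ k₁ + k₂
    1+ν₁+ν₂≡k₁+k₂ = trans (cong suc (sym (trans (cong nullity B≡B₁∪B₂) (nullity-∪ B₁#B₂ skew₁₂))))
                          (predFoldCircuit⇒nullity B-pred)
    ν₁≤k₁ : nullity B₁ ≤ k₁
    ν₁≤k₁ = ≤-trans (nullity-mono (p∩q⊆q B D₁)) (≤-reflexive (foldCircuit⇒nullity D₁-fold))
    ν₂≤k₂ : nullity B₂ ≤ k₂
    ν₂≤k₂ = ≤-trans (nullity-mono (p∩q⊆q B D₂)) (≤-reflexive (foldCircuit⇒nullity D₂-fold))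
    same-nullity⇒≡ : ∀ {k Bᵢ Dᵢ} → FoldCircuit M k Dᵢ → Bᵢ ⊆ Dᵢ → nullity Bᵢ ≡ k → Bᵢ ≡ Dᵢ
    same-nullity⇒≡ Dᵢ-fold Bᵢ⊆Dᵢ νᵢ≡k = ⊆-antisym Bᵢ⊆Dᵢ
      (cyclic-⊆ (proj₁ Dᵢ-fold) Bᵢ⊆Dᵢ (≤-reflexive (trans (foldCircuit⇒nullity Dᵢ-fold) (sym νᵢ≡k))))
    first-part : suc (nullity B₁) ≡ k₁ × nullity B₂ ≡ k₂ →
                 ∃[ B₁ ] (B₁ ⊆ D₁ × PredFoldCircuit M k₁ B₁ × B ≡ B₁ ∪ D₂)
    first-part (1+ν₁≡k₁ , ν₂≡k₂) =
      B₁ , p∩q⊆q B D₁ ,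
      nullity⇒predFoldCircuit (cyclic-skew-part B₁#B₂ skew₁₂ cyclic₁₂) 1+ν₁≡k₁ ,
      trans B≡B₁∪B₂ (cong (B₁ ∪_) (same-nullity⇒≡ D₂-fold (p∩q⊆q B D₂) ν₂≡k₂))
    second-part : nullity B₁ ≡ k₁ × suc (nullity B₂) ≡ k₂ →
                  ∃[ B₂ ] (B₂ ⊆ D₂ × PredFoldCircuit M k₂ B₂ × B ≡ D₁ ∪ B₂)
    second-part (ν₁≡k₁ , 1+ν₂≡k₂) =
      B₂ , p∩q⊆q B D₂ ,
      nullity⇒predFoldCircuit
        (cyclic-skew-part (disjoint-sym B₁#B₂) (skew-sym skew₁₂) (subst (Cyclic M) (∪-comm B₁ B₂) cyclic₁₂))
        1+ν₂≡k₂ ,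
      trans B≡B₁∪B₂ (cong (_∪ B₂) (same-nullity⇒≡ D₁-fold (p∩q⊆q B D₁) ν₁≡k₁))

  enumerates-∪ : ∀ {As₁ As₂} → Disjoint D₁ D₂ → Skew D₁ D₂ →
                 (D₁-fold : FoldCircuit M k₁ D₁) → (D₂-fold : FoldCircuit M k₂ D₂) →
                 EnumeratesPrincipalPartition M k₁ D₁ As₁ → EnumeratesPrincipalPartition M k₂ D₂ As₂ →
                 EnumeratesPrincipalPartition M (k₁ + k₂) (D₁ ∪ D₂) (As₁ ++ As₂)
  enumerates-∪ {D₁} {D₂} {k₁} {k₂} {As₁} {As₂} D₁#D₂ skew D₁-fold D₂-fold enum₁ enum₂ =
    ++⁺ (proj₁ enum₁) (proj₁ enum₂) no-common-piece , λ _ → mk⇔ to from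
    where
    module P₁ = PrincipalPartition D₁-fold enum₁
    module P₂ = PrincipalPartition D₂-fold enum₂
    [D₁∪D₂]─[B∪D₂]≡D₁─B : (D₁ ∪ D₂) ─ (B ∪ D₂) ≡ D₁ ─ B
    [D₁∪D₂]─[B∪D₂]≡D₁─B = [p∪q]─[s∪q]≡p─s D₁#D₂
    [D₁∪D₂]─[D₁∪B]≡D₂─B : (D₁ ∪ D₂) ─ (D₁ ∪ B) ≡ D₂ ─ B
    [D₁∪D₂]─[D₁∪B]≡D₂─B {B} =
      trans (cong₂ _─_ (∪-comm D₁ D₂) (∪-comm D₁ B)) ([p∪q]─[s∪q]≡p─s (disjoint-sym D₁#D₂))
    no-common-piece : ∀ {A} → ¬ (A ∈ₗ As₁ × A ∈ₗ As₂)
    no-common-piece (A∈As₁ , A∈As₂) =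
      let (x , x∈A) = P₁.piece-nonempty A∈As₁ in D₁#D₂ (P₁.piece-⊆ A∈As₁ x∈A) (P₂.piece-⊆ A∈As₂ x∈A)
    to : ∀ {A} → A ∈ₗ As₁ ++ As₂ →
         ∃[ B ] (B ⊆ D₁ ∪ D₂ × PredFoldCircuit M (k₁ + k₂) B × A ≡ (D₁ ∪ D₂) ─ B)
    to A∈ with ∈-++⁻ As₁ A∈
    ... | inj₁ A∈As₁ = let (B , B⊆D₁ , B-pred , A≡D₁─B) = P₁.piece⁻ A∈As₁ in
      B ∪ D₂ , ∪-mono B⊆D₁ ⊆-refl , predFoldCircuit-∪ˡ D₁#D₂ skew B⊆D₁ B-pred D₂-fold ,
      trans A≡D₁─B (sym [D₁∪D₂]─[B∪D₂]≡D₁─B)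
    ... | inj₂ A∈As₂ = let (B , B⊆D₂ , B-pred , A≡D₂─B) = P₂.piece⁻ A∈As₂ in
      D₁ ∪ B , ∪-mono ⊆-refl B⊆D₂ , predFoldCircuit-∪ʳ D₁#D₂ skew B⊆D₂ D₁-fold B-pred ,
      trans A≡D₂─B (sym [D₁∪D₂]─[D₁∪B]≡D₂─B)
    from : ∀ {A} → ∃[ B ] (B ⊆ D₁ ∪ D₂ × PredFoldCircuit M (k₁ + k₂) B × A ≡ (D₁ ∪ D₂) ─ B) →
           A ∈ₗ As₁ ++ As₂
    from (B , B⊆D , B-pred , refl) with predFoldCircuit-split D₁#D₂ skew D₁-fold D₂-fold B⊆D B-pred
    ... | inj₁ (B₁ , B₁⊆D₁ , B₁-pred , refl) =
      ∈-++⁺ˡ (subst (_∈ₗ As₁) (sym [D₁∪D₂]─[B∪D₂]≡D₁─B) (P₁.piece⁺ B₁⊆D₁ B₁-pred))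
    ... | inj₂ (B₂ , B₂⊆D₂ , B₂-pred , refl) =
      ∈-++⁺ʳ As₁ (subst (_∈ₗ As₂) (sym [D₁∪D₂]─[D₁∪B]≡D₂─B) (P₂.piece⁺ B₂⊆D₂ B₂-pred))

  balanced-∪ : Disjoint D₁ D₂ → Skew D₁ D₂ → Nonempty D₁ → Nonempty D₂ →
               Balanced M k₁ D₁ → Balanced M k₂ D₂ → Balanced M (k₁ + k₂) (D₁ ∪ D₂)
  balanced-∪ {D₁} {D₂} {k₁} {k₂} D₁#D₂ skew (x₁ , x₁∈D₁) (x₂ , x₂∈D₂)
             (D₁-fold , As₁ , enum₁ , balanced₁) (D₂-fold , As₂ , enum₂ , balanced₂) =
    D-fold , As₁ ++ As₂ , enum , ≤-antisym (P.r[⋂cl]+k≤ℓ (x₁ , p⊆p∪q D₂ x₁∈D₁)) (begin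
      length (As₁ ++ As₂)                          ≡⟨ length-++ As₁ ⟩
      length As₁ + length As₂                      ≡⟨ cong₂ _+_ (sym balanced₁) (sym balanced₂) ⟩
      (r ⋂₁ + k₁) + (r ⋂₂ + k₂)                    ≡⟨ interchange (r ⋂₁) k₁ (r ⋂₂) k₂ ⟩
      (r ⋂₁ + r ⋂₂) + (k₁ + k₂)                    ≡⟨ cong (_+ (k₁ + k₂)) (sym ⋂₁-⋂₂-skew) ⟩
      r (⋂₁ ∪ ⋂₂) + (k₁ + k₂)                      ≤⟨ +-monoˡ-≤ (k₁ + k₂) (r-mono (∪-lub ⋂₁⊆⋂ ⋂₂⊆⋂)) ⟩
      r (⋂cl (D₁ ∪ D₂) (As₁ ++ As₂)) + (k₁ + k₂)   ∎)
    where
    open ≤-Reasoning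
    D-fold = foldCircuit-∪ D₁#D₂ skew D₁-fold D₂-fold
    enum = enumerates-∪ D₁#D₂ skew D₁-fold D₂-fold enum₁ enum₂
    module P = PrincipalPartition D-fold enum
    module P₁ = PrincipalPartition D₁-fold enum₁
    module P₂ = PrincipalPartition D₂-fold enum₂
    ⋂₁ = ⋂cl D₁ As₁
    ⋂₂ = ⋂cl D₂ As₂
    ⋂₁⊆clD₁ : ⋂₁ ⊆ cl M D₁
    ⋂₁⊆clD₁ = cl-mono (p─q⊆p D₁ _) ∘ ⋂cl⊆ (proj₁ (proj₂ (P₁.pieces-cover x₁∈D₁)))
    ⋂₂⊆clD₂ : ⋂₂ ⊆ cl M D₂
    ⋂₂⊆clD₂ = cl-mono (p─q⊆p D₂ _) ∘ ⋂cl⊆ (proj₁ (proj₂ (P₂.pieces-cover x₂∈D₂)))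
    ⋂₁-⋂₂-skew : Skew ⋂₁ ⋂₂
    ⋂₁-⋂₂-skew = skew-⊆cl ⋂₁⊆clD₁ ⋂₂⊆clD₂ skew
    D₁⊆[D₁∪D₂]─A : A ∈ₗ As₂ → D₁ ⊆ (D₁ ∪ D₂) ─ A
    D₁⊆[D₁∪D₂]─A A∈As₂ y∈D₁ = x∈p∧x∉q⇒x∈p─q (p⊆p∪q D₂ y∈D₁) (D₁#D₂ y∈D₁ ∘ P₂.piece-⊆ A∈As₂)
    D₂⊆[D₁∪D₂]─A : A ∈ₗ As₁ → D₂ ⊆ (D₁ ∪ D₂) ─ A
    D₂⊆[D₁∪D₂]─A A∈As₁ y∈D₂ =
      x∈p∧x∉q⇒x∈p─q (q⊆p∪q D₁ D₂ y∈D₂) (λ y∈A → D₁#D₂ (P₁.piece-⊆ A∈As₁ y∈A) y∈D₂)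
    ⋂₁⊆⋂ : ⋂₁ ⊆ ⋂cl (D₁ ∪ D₂) (As₁ ++ As₂)
    ⋂₁⊆⋂ x∈⋂₁ = ∈⋂cl⁺ (λ A∈ → [ (λ A∈As₁ → cl-mono (p⊆q⇒p─s⊆q─s (p⊆p∪q D₂)) (⋂cl⊆ A∈As₁ x∈⋂₁))
                                , (λ A∈As₂ → cl-mono (D₁⊆[D₁∪D₂]─A A∈As₂) (⋂₁⊆clD₁ x∈⋂₁))
                                ]′ (∈-++⁻ As₁ A∈))
    ⋂₂⊆⋂ : ⋂₂ ⊆ ⋂cl (D₁ ∪ D₂) (As₁ ++ As₂)
    ⋂₂⊆⋂ x∈⋂₂ = ∈⋂cl⁺ (λ A∈ → [ (λ A∈As₁ → cl-mono (D₂⊆[D₁∪D₂]─A A∈As₁) (⋂₂⊆clD₂ x∈⋂₂))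
                                , (λ A∈As₂ → cl-mono (p⊆q⇒p─s⊆q─s (q⊆p∪q D₁ D₂)) (⋂cl⊆ A∈As₂ x∈⋂₂))
                                ]′ (∈-++⁻ As₁ A∈))

  -- Decomposition into components

  module _ {D : Subset n} (components-balanced : ∀ C → IsComponent M D C → ∃[ k ] Balanced M k C)
    where

    Saturated : Subset n → Set
    Saturated R = ∀ {y z} → y ∈ R → Related M D y z → z ∈ R

    saturated-balanced : ∀ R → R ⊆ D → Saturated R → Nonempty R → ∃[ k ] Balanced M k R
    saturated-balanced R = go R (<-wellFounded ∣ R ∣)
      where
      go : ∀ R → Acc _<_ ∣ R ∣ → R ⊆ D → Saturated R → Nonempty R → ∃[ k ] Balanced M k R
      go R (acc smaller) R⊆D R-saturated (x , x∈R) = split (R ⊆? Dₓ)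
        where
        Dₓ = component D x
        x∈Dₓ : x ∈ Dₓ
        x∈Dₓ = ∈component⁺ (R⊆D x∈R) (inj₁ refl)
        Dₓ⊆R : Dₓ ⊆ R
        Dₓ⊆R z∈Dₓ = R-saturated x∈R (proj₂ (∈component⁻ z∈Dₓ))
        Dₓ-balanced : ∃[ k ] Balanced M k Dₓ
        Dₓ-balanced = components-balanced Dₓ (component-isComponent (R⊆D x∈R))
        R′ = R ─ Dₓ
        R′⊆D : R′ ⊆ D
        R′⊆D = R⊆D ∘ p─q⊆p R Dₓ
        Dₓ#R′ : Disjoint Dₓ R′
        Dₓ#R′ z∈Dₓ z∈R′ = proj₂ (x∈p─q⁻ z∈R′) z∈Dₓ
        R′-saturated : Saturated R′
        R′-saturated {y} {z} y∈R′ y~z = x∈p∧x∉q⇒x∈p─q (R-saturated (p─q⊆p R Dₓ y∈R′) y~z) z∉Dₓ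
          where
          z∉Dₓ : z ∉ Dₓ
          z∉Dₓ z∈Dₓ = proj₂ (x∈p─q⁻ y∈R′)
            (∈component⁺ (R′⊆D y∈R′) (Related-trans (proj₂ (∈component⁻ z∈Dₓ)) (Related-sym y~z)))
        R′⊂R : R′ ⊂ R
        R′⊂R = p─q⊆p R Dₓ , x , x∈R , Dₓ#R′ x∈Dₓ
        Dₓ-R′-skew : Skew Dₓ R′
        Dₓ-R′-skew = separator⇒skew Dₓ#R′ (λ C circ C⊆ → component-separator C circ C⊆ R′⊆D)
        split : Dec (R ⊆ Dₓ) → ∃[ k ] Balanced M k R
        split (yes R⊆Dₓ) = subst (λ S → ∃[ k ] Balanced M k S) (⊆-antisym Dₓ⊆R R⊆Dₓ) Dₓ-balanced
        split (no R⊈Dₓ) =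
          let (y , y∈R , y∉Dₓ) = ⊈⇒∃∉ R⊈Dₓ
              y∈R′ = x∈p∧x∉q⇒x∈p─q y∈R y∉Dₓ
              (k₁ , Dₓ-balanced′) = Dₓ-balanced
              (k₂ , R′-balanced) = go R′ (smaller (p⊂q⇒∣p∣<∣q∣ R′⊂R)) R′⊆D R′-saturated (y , y∈R′)
          in subst (λ S → ∃[ k ] Balanced M k S) (p∪[q─p]≡q Dₓ⊆R)
               (k₁ + k₂ , balanced-∪ Dₓ#R′ Dₓ-R′-skew (x , x∈Dₓ) (y , y∈R′) Dₓ-balanced′ R′-balanced)

-- A connected D is its own component, so disconnectedness of M|D is only needed for D to be nonempty.
mainTheorem3 : {n : ℕ} (M : Matroid n) (D : Subset n) (k : ℕ) →
    FoldCircuit M k D →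
    RestrictionDisconnected M D →
    (∀ C → IsComponent M D C → ∃[ kC ] Balanced M kC C) →
    Balanced M k D
mainTheorem3 M D k D-fold (e , _ , e∈D , _) components-balanced =
  let (_ , D-balanced) = saturated-balanced M components-balanced D ⊆-refl (Related⇒∈ M) (e , e∈D)
  in subst (λ j → Balanced M j D) (foldCircuit-unique M (proj₁ D-balanced) D-fold) D-balanced
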